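{- Let $H$ be an $r$-uniform hypergraph, let $k\ge 1$ and $n$ be positive integers, and suppose \[ n<\Big(1-\mathrm{ex}(n,H)\big/\tbinom{n}{r}\Big)^{ -k/r}. \] Then $R_\ell(H,k)>n$.
   Context: An $r$-graph is an $r$-uniform hypergraph; $K_n^{(r)}$ is the complete $r$-graph on $n$ vertices. $\mathrm{ex}(n,H)$ is the maximum number of edges in an $r$-graph on $n$ vertices containing no copy of $H$. For a list assignment $L:E(K_n^{(r)})\to\binom{\mathbb N}{k}$ (each edge receives a set of $k$ colors), an $L$-coloring is an edge-coloring in which each edge $e$ receives a color from $L(e)$. The $k$-color list Ramsey number $R_\ell(H,k)$ is the smallest $n$ such that there exists $L:E(K_n^{(r)})\to\binom{\mathbb N}{k}$ for which every $L$-coloring of $K_n^{(r)}$ contains a monochromatic copy of $H$. -}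

module Defs where

open import Data.Nat using (ℕ; zero; suc; _≡ᵇ_)
open import Data.Bool using (Bool; true; false; _∧_)
open import Data.Fin using (Fin)
open import Data.Fin.Subset using (Subset; _∈_; ∣_∣)
open import Data.Vec using (_∷_; [])
open import Data.List using (List; _∷_; []; map; _++_; filter; length)
open import Data.Product using (Σ; _×_; ∃; _,_; proj₁)
open import Relation.Binary.PropositionalEquality using (_≡_)
open import Relation.Nullary using (¬_)
open import Function.Definitions using (Injective)
open import Data.Bool.Properties using (T?)

-- Only subsets of size exactly r with indicator true are edges
-- (values of the indicator on subsets of other sizes are ignored).
RGraph : ℕ → Set
RGraph n = Subset n → Bool

IsEdge : (r : ℕ) {n : ℕ} → RGraph n → Subset n → Set
IsEdge r G s = (∣ s ∣ ≡ r) × (G s ≡ true)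

allSubsets : (n : ℕ) → List (Subset n)
allSubsets zero = [] ∷ []
allSubsets (suc n) = map (true ∷_) (allSubsets n) ++ map (false ∷_) (allSubsets n)

edgeCount : (r : ℕ) {n : ℕ} → RGraph n → ℕ
edgeCount r {n} G = length (filter (λ s → T? ((∣ s ∣ ≡ᵇ r) ∧ G s)) (allSubsets n))

ImageOf : {v n : ℕ} → (Fin v → Fin n) → Subset v → Subset n → Set
ImageOf {v} φ s t =
  (y : Fin _) → ((y ∈ t → Σ (Fin v) λ x → (x ∈ s) × (φ x ≡ y))
               × (Σ (Fin v) (λ x → (x ∈ s) × (φ x ≡ y)) → y ∈ t))

ContainsCopy : (r : ℕ) {v n : ℕ} → RGraph v → RGraph n → Set
ContainsCopy r {v} {n} H G =
  Σ (Fin v → Fin n) λ φ → Injective _≡_ _≡_ φ ×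
    ((s : Subset v) → IsEdge r H s →
       Σ (Subset n) λ t → ImageOf φ s t × IsEdge r G t)

IsEx : (r n : ℕ) {v : ℕ} → RGraph v → ℕ → Set
IsEx r n H m =
  (Σ (RGraph n) λ G → ¬ ContainsCopy r H G × (edgeCount r G ≡ m))
  × ((G : RGraph n) → ¬ ContainsCopy r H G → edgeCount r G Data.Nat.≤ m)

ListAssignment : (r k n : ℕ) → Set
ListAssignment r k n =
  Σ (Subset n → Fin k → ℕ) λ L → (s : Subset n) → ∣ s ∣ ≡ r → Injective _≡_ _≡_ (L s)

IsLColouring : {r k n : ℕ} → ListAssignment r k n → (Subset n → ℕ) → Set
IsLColouring {r} {k} {n} (L , _) c = (s : Subset n) → ∣ s ∣ ≡ r → ∃ λ (i : Fin k) → L s i ≡ c s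


MonoCopy : (r : ℕ) {v n : ℕ} → RGraph v → (Subset n → ℕ) → Set
MonoCopy r {v} {n} H c =
  Σ ℕ λ col → Σ (Fin v → Fin n) λ φ → Injective _≡_ _≡_ φ ×
    ((s : Subset v) → IsEdge r H s →
       Σ (Subset n) λ t → ImageOf φ s t × (∣ t ∣ ≡ r) × (c t ≡ col))

ListRamseyHolds : (r : ℕ) {v : ℕ} → RGraph v → (k n : ℕ) → Set
ListRamseyHolds r H k n =
  Σ (ListAssignment r k n) λ L → (c : Subset n → ℕ) → IsLColouring L c → MonoCopy r H c

-- R_ℓ(H,k) > n  (R_ℓ is the least n for which ListRamseyHolds; +∞ if none).
ListRamseyGreater : (r : ℕ) {v : ℕ} → RGraph v → (k n : ℕ) → Set
ListRamseyGreater r H k n = (n' : ℕ) → n' Data.Nat.≤ n → ¬ ListRamseyHolds r H k n'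

{-# OPTIONS --safe #-}

-- Fix an H-free r-graph G on n vertices with ex edges and put N = C(n,r). Given k-lists L,
-- give every colour c a uniformly random relabelling σ_c of G, independently, and colour each
-- r-set e by a colour c ∈ L(e) for which e is an edge of σ_c(G). Every colour class then lies
-- in a copy of G, so no colour class contains H. A fixed r-set misses σ_c(G) with probability
-- 1 − ex/N, and misses all of its k distinct colours with probability (1 − ex/N)^k; hence the
-- expected number of r-sets left uncoloured is N (1 − ex/N)^k ≤ n^r (N − ex)^k / N^k < 1.
-- The expectation is derandomised by conditional expectations: colours are fixed one at a time,
-- each receiving a relabelling that does not increase the potential N^k · E[#uncoloured].
-- A colourable K_n stays colourable after deleting vertices, which gives R_ℓ(H,k) > n.
module Submission where

open import Defs
open import Data.Bool as Bool using (Bool; true; false; _∧_; not; T; if_then_else_)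
open import Data.Bool.Properties using (T?; T-≡)
open import Data.Empty using (⊥; ⊥-elim)
open import Data.Fin as Fin using (Fin; zero; suc)
import Data.Fin.Properties as Fin
open import Data.Fin.Permutation as Perm using (Permutation′; _⟨$⟩ʳ_; _⟨$⟩ˡ_; inverseˡ; inverseʳ; lift₀; _∘ₚ_)
open import Data.Fin.Subset using (Subset; ∣_∣; _∈_)
open import Data.Fin.Subset.Properties using (∣⊥∣≡0)
open import Data.List as List using (List; []; _∷_; _++_; map)
import Data.List.Properties as List
open import Data.List.Membership.Propositional using (lose) renaming (_∈_ to _∈ₗ_; _∉_ to _∉ₗ_)
open import Data.List.Membership.Propositional.Properties using (∈-++⁺ˡ; ∈-++⁺ʳ; ∈-map⁺; ∈-concatMap⁺; ∈-tabulate⁺)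
open import Data.List.Relation.Unary.Any using (here; there)
open import Data.Nat as ℕ using (ℕ; zero; suc; _+_; _*_; _∸_; _^_; _≤_; _<_; z≤n)
open import Data.Nat.Combinatorics using (_C_; nCk+nC[k+1]≡[n+1]C[k+1])
open import Data.Nat.Properties
open import Algebra.Properties.CommutativeSemigroup +-commutativeSemigroup using (interchange)
open import Algebra.Properties.CommutativeSemigroup *-commutativeSemigroup using (x∙yz≈y∙xz; xy∙z≈zy∙x)
open import Data.Nat.Tactic.RingSolver using (solve-∀)
open import Data.List.Membership.DecPropositional ℕ._≟_ using (_∈?_)
open import Data.Product using (Σ; _×_; _,_; proj₁; proj₂)
open import Data.Sum using (inj₁; inj₂)
open import Data.Vec as Vec using (Vec; []; _∷_; lookup; tabulate)
import Data.Vec.Properties as Vec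
open import Function using (id; _∘_; _⇔_; mk⇔)
open import Function.Bundles using (_↔_; Inverse; mk↔ₛ′; Equivalence)
open import Function.Definitions using (Injective)
open import Relation.Binary.Definitions using (DecidableEquality)
open import Relation.Binary.PropositionalEquality
open import Relation.Nullary using (¬_; Dec; yes; no; does; _→-dec_; _×-dec_)
open import Relation.Nullary.Decidable using (dec-true; dec-false; does-⇔; map′)

∑ : {A : Set} → List A → (A → ℕ) → ℕ
∑ [] f = 0
∑ (x ∷ xs) f = f x + ∑ xs f

module _ {A : Set} where

  ∑-cong : (xs : List A) {f g : A → ℕ} → (∀ x → f x ≡ g x) → ∑ xs f ≡ ∑ xs g
  ∑-cong [] f≡g = refl
  ∑-cong (x ∷ xs) f≡g = cong₂ _+_ (f≡g x) (∑-cong xs f≡g)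

  ∑-mono-≤ : (xs : List A) {f g : A → ℕ} → (∀ x → f x ≤ g x) → ∑ xs f ≤ ∑ xs g
  ∑-mono-≤ [] f≤g = z≤n
  ∑-mono-≤ (x ∷ xs) f≤g = +-mono-≤ (f≤g x) (∑-mono-≤ xs f≤g)

  ∑-zero : (xs : List A) → ∑ xs (λ _ → 0) ≡ 0
  ∑-zero [] = refl
  ∑-zero (x ∷ xs) = ∑-zero xs

  ∑-++ : (xs ys : List A) (f : A → ℕ) → ∑ (xs ++ ys) f ≡ ∑ xs f + ∑ ys f
  ∑-++ [] ys f = refl
  ∑-++ (x ∷ xs) ys f = trans (cong (f x +_) (∑-++ xs ys f)) (sym (+-assoc (f x) _ _))

  ∑-+ : (xs : List A) (f g : A → ℕ) → ∑ xs (λ x → f x + g x) ≡ ∑ xs f + ∑ xs g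
  ∑-+ [] f g = refl
  ∑-+ (x ∷ xs) f g = trans (cong (f x + g x +_) (∑-+ xs f g)) (interchange (f x) (g x) _ _)

  *-distribˡ-∑ : (a : ℕ) (xs : List A) (f : A → ℕ) → a * ∑ xs f ≡ ∑ xs (λ x → a * f x)
  *-distribˡ-∑ a [] f = *-zeroʳ a
  *-distribˡ-∑ a (x ∷ xs) f = trans (*-distribˡ-+ a (f x) _) (cong (a * f x +_) (*-distribˡ-∑ a xs f))

  *-distribʳ-∑ : (a : ℕ) (xs : List A) (f : A → ℕ) → ∑ xs f * a ≡ ∑ xs (λ x → f x * a)
  *-distribʳ-∑ a xs f = trans (*-comm _ a) (trans (*-distribˡ-∑ a xs f) (∑-cong xs (λ x → *-comm a (f x))))

module _ {A B : Set} where

  ∑-map : (g : A → B) (xs : List A) (f : B → ℕ) → ∑ (map g xs) f ≡ ∑ xs (f ∘ g)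
  ∑-map g [] f = refl
  ∑-map g (x ∷ xs) f = cong (f (g x) +_) (∑-map g xs f)

  ∑-comm : (xs : List A) (ys : List B) (f : A → B → ℕ) →
    ∑ xs (λ x → ∑ ys (f x)) ≡ ∑ ys (λ y → ∑ xs (λ x → f x y))
  ∑-comm [] ys f = sym (∑-zero ys)
  ∑-comm (x ∷ xs) ys f =
    trans (cong (∑ ys (f x) +_) (∑-comm xs ys f)) (sym (∑-+ ys (f x) (λ y → ∑ xs (λ x′ → f x′ y))))

  ∑-concatMap : (g : A → List B) (xs : List A) (f : B → ℕ) →
    ∑ (List.concatMap g xs) f ≡ ∑ xs (λ x → ∑ (g x) f)
  ∑-concatMap g [] f = refl
  ∑-concatMap g (x ∷ xs) f = trans (∑-++ (g x) _ f) (cong (∑ (g x) f +_) (∑-concatMap g xs f))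

∏ : (k : ℕ) → (Fin k → ℕ) → ℕ
∏ zero f = 1
∏ (suc k) f = f zero * ∏ k (f ∘ suc)

∏-cong : (k : ℕ) {f g : Fin k → ℕ} → (∀ i → f i ≡ g i) → ∏ k f ≡ ∏ k g
∏-cong zero f≗g = refl
∏-cong (suc k) f≗g = cong₂ _*_ (f≗g zero) (∏-cong k (f≗g ∘ suc))

∏-const : (k a : ℕ) → ∏ k (λ _ → a) ≡ a ^ k
∏-const zero a = refl
∏-const (suc k) a = cong (a *_) (∏-const k a)

∏-exchange : (k : ℕ) (f g : Fin k → ℕ) (i : Fin k) → (∀ j → j ≢ i → f j ≡ g j) → ∏ k f * g i ≡ ∏ k g * f i
∏-exchange (suc k) f g zero f≡g = begin
  f zero * ∏ k (f ∘ suc) * g zero   ≡⟨ cong (λ p → f zero * p * g zero) (∏-cong k (λ j → f≡g (suc j) λ ())) ⟩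
  f zero * ∏ k (g ∘ suc) * g zero   ≡⟨ xy∙z≈zy∙x (f zero) _ (g zero) ⟩
  g zero * ∏ k (g ∘ suc) * f zero   ∎
  where open ≡-Reasoning
∏-exchange (suc k) f g (suc i) f≡g = begin
  f zero * ∏ k (f ∘ suc) * g (suc i)     ≡⟨ *-assoc (f zero) _ _ ⟩
  f zero * (∏ k (f ∘ suc) * g (suc i))   ≡⟨ cong₂ _*_ (f≡g zero λ ()) (∏-exchange k (f ∘ suc) (g ∘ suc) i λ j j≢i → f≡g (suc j) (j≢i ∘ Fin.suc-injective)) ⟩
  g zero * (∏ k (g ∘ suc) * f (suc i))   ≡⟨ *-assoc (g zero) _ _ ⟨
  g zero * ∏ k (g ∘ suc) * f (suc i)     ∎
  where open ≡-Reasoning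

𝟙 : Bool → ℕ
𝟙 true = 1
𝟙 false = 0

𝟙[_] : {P : Set} → Dec P → ℕ
𝟙[ p? ] = 𝟙 (does p?)

𝟙-∧ : ∀ a b → 𝟙 (a ∧ b) ≡ 𝟙 a * 𝟙 b
𝟙-∧ true b = sym (+-identityʳ (𝟙 b))
𝟙-∧ false b = refl

𝟙-not : ∀ b → 𝟙 (not b) + 𝟙 b ≡ 1
𝟙-not true = refl
𝟙-not false = refl

𝟙≤1 : ∀ b → 𝟙 b ≤ 1
𝟙≤1 true = ≤-refl
𝟙≤1 false = z≤n

𝟙[]-yes : {P : Set} (p? : Dec P) → P → 𝟙[ p? ] ≡ 1
𝟙[]-yes p? p = cong 𝟙 (dec-true p? p)

𝟙[]-no : {P : Set} (p? : Dec P) → ¬ P → 𝟙[ p? ] ≡ 0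
𝟙[]-no p? ¬p = cong 𝟙 (dec-false p? ¬p)

𝟙[]-⇔ : {P Q : Set} → P ⇔ Q → (p? : Dec P) (q? : Dec Q) → 𝟙[ p? ] ≡ 𝟙[ q? ]
𝟙[]-⇔ P⇔Q p? q? = cong 𝟙 (does-⇔ P⇔Q p? q?)

𝟙[]*-cong : {P : Set} (p? : Dec P) {x y : ℕ} → (P → x ≡ y) → 𝟙[ p? ] * x ≡ 𝟙[ p? ] * y
𝟙[]*-cong (yes p) x≡y = cong (_+ 0) (x≡y p)
𝟙[]*-cong (no _) _ = refl

∃-below-average : {A : Set} {P : A → Set} (P? : ∀ x → Dec (P x)) (xs : List A) (f : A → ℕ) (b : ℕ) →
  ∑ xs (λ x → 𝟙[ P? x ] * f x) < ∑ xs (λ x → 𝟙[ P? x ]) * b → Σ A λ x → P x × f x < b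
∃-below-average P? (x ∷ xs) f b avg<b with P? x | f x <? b
... | yes px | yes fx<b = x , px , fx<b
... | yes px | no fx≮b = ∃-below-average P? xs f b (+-cancelˡ-< b _ _ (begin-strict
  b + ∑ xs (λ x → 𝟙[ P? x ] * f x)        ≤⟨ +-monoˡ-≤ _ (≤-trans (≮⇒≥ fx≮b) (≤-reflexive (sym (*-identityˡ (f x))))) ⟩
  1 * f x + ∑ xs (λ x → 𝟙[ P? x ] * f x)  <⟨ avg<b ⟩
  b + ∑ xs (λ x → 𝟙[ P? x ]) * b          ∎))
  where open ≤-Reasoning
... | no _ | _ = ∃-below-average P? xs f b avg<b

module _ {A : Set} (_≟_ : DecidableEquality A) where

  count : List A → A → ℕ
  count xs z = ∑ xs (λ x → 𝟙[ x ≟ z ])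

  Enumerates : List A → Set
  Enumerates xs = ∀ z → count xs z ≡ 1

  𝟙[≟]*-swap : (f : A → ℕ) (x y : A) → 𝟙[ y ≟ x ] * f x ≡ 𝟙[ x ≟ y ] * f y
  𝟙[≟]*-swap f x y with y ≟ x
  ... | yes refl = cong (_* f x) (sym (𝟙[]-yes (x ≟ x) refl))
  ... | no y≢x = cong (_* f y) (sym (𝟙[]-no (x ≟ y) (y≢x ∘ sym)))

  ∑-via-count : (ys : List A) → Enumerates ys → (xs : List A) (f : A → ℕ) →
    ∑ xs f ≡ ∑ ys (λ y → count xs y * f y)
  ∑-via-count ys enum xs f = begin
    ∑ xs f                                          ≡⟨ ∑-cong xs (λ x → sym (trans (cong (_* f x) (enum x)) (*-identityˡ (f x)))) ⟩
    ∑ xs (λ x → count ys x * f x)                   ≡⟨ ∑-cong xs (λ x → *-distribʳ-∑ (f x) ys _) ⟩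
    ∑ xs (λ x → ∑ ys (λ y → 𝟙[ y ≟ x ] * f x))      ≡⟨ ∑-comm xs ys _ ⟩
    ∑ ys (λ y → ∑ xs (λ x → 𝟙[ y ≟ x ] * f x))      ≡⟨ ∑-cong ys (λ y → ∑-cong xs (λ x → 𝟙[≟]*-swap f x y)) ⟩
    ∑ ys (λ y → ∑ xs (λ x → 𝟙[ x ≟ y ] * f y))      ≡⟨ ∑-cong ys (λ y → sym (*-distribʳ-∑ (f y) xs _)) ⟩
    ∑ ys (λ y → count xs y * f y)                   ∎
    where open ≡-Reasoning

  ∑-enumerations : (xs ys : List A) → Enumerates xs → Enumerates ys → (f : A → ℕ) → ∑ xs f ≡ ∑ ys f
  ∑-enumerations xs ys enum-xs enum-ys f =
    trans (∑-via-count ys enum-ys xs f) (∑-cong ys (λ y → trans (cong (_* f y) (enum-xs y)) (*-identityˡ (f y))))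

  Enumerates-map : (xs : List A) (σ : A ↔ A) → Enumerates xs → Enumerates (map (Inverse.to σ) xs)
  Enumerates-map xs σ enum z = trans (∑-map (Inverse.to σ) xs _)
    (trans (∑-cong xs (λ x → 𝟙[]-⇔ to≡⇔≡from (Inverse.to σ x ≟ z) (x ≟ Inverse.from σ z))) (enum (Inverse.from σ z)))
    where
    to≡⇔≡from : ∀ {x} → Inverse.to σ x ≡ z ⇔ x ≡ Inverse.from σ z
    to≡⇔≡from {x} = mk⇔ (λ e → trans (sym (Inverse.strictlyInverseʳ σ x)) (cong (Inverse.from σ) e))
                         (λ e → trans (cong (Inverse.to σ) e) (Inverse.strictlyInverseˡ σ z))

  ∑-reindex : (xs : List A) (σ : A ↔ A) → Enumerates xs → (f : A → ℕ) → ∑ xs (f ∘ Inverse.to σ) ≡ ∑ xs f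
  ∑-reindex xs σ enum f = trans (sym (∑-map (Inverse.to σ) xs f)) (∑-enumerations (map (Inverse.to σ) xs) xs (Enumerates-map xs σ enum) enum f)

  term≤∑ : (xs : List A) → Enumerates xs → (f : A → ℕ) (z : A) → f z ≤ ∑ xs f
  term≤∑ xs enum f z = begin
    f z                                ≡⟨ sym (*-identityˡ (f z)) ⟩
    1 * f z                            ≡⟨ cong (_* f z) (sym (enum z)) ⟩
    count xs z * f z                   ≡⟨ *-distribʳ-∑ (f z) xs _ ⟩
    ∑ xs (λ x → 𝟙[ x ≟ z ] * f z)      ≡⟨ ∑-cong xs (λ x → sym (𝟙[≟]*-swap f x z)) ⟩
    ∑ xs (λ x → 𝟙[ z ≟ x ] * f x)      ≤⟨ ∑-mono-≤ xs (λ x → ≤-trans (*-monoˡ-≤ (f x) (𝟙≤1 (does (z ≟ x)))) (≤-reflexive (*-identityˡ (f x)))) ⟩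
    ∑ xs f                             ∎
    where open ≤-Reasoning

fins : (n : ℕ) → List (Fin n)
fins zero = []
fins (suc n) = zero ∷ map suc (fins n)

fins-enumerates : (n : ℕ) → Enumerates Fin._≟_ (fins n)
fins-enumerates (suc n) zero = cong suc (begin
  ∑ (map suc (fins n)) (λ x → 𝟙[ x Fin.≟ zero ])  ≡⟨ ∑-map suc (fins n) _ ⟩
  ∑ (fins n) (λ x → 𝟙[ suc x Fin.≟ zero ])       ≡⟨ ∑-cong (fins n) (λ x → 𝟙[]-no (suc x Fin.≟ zero) λ ()) ⟩
  ∑ (fins n) (λ _ → 0)                            ≡⟨ ∑-zero (fins n) ⟩
  0                                               ∎)
  where open ≡-Reasoning
fins-enumerates (suc n) (suc z) = begin
  ∑ (map suc (fins n)) (λ x → 𝟙[ x Fin.≟ suc z ])  ≡⟨ ∑-map suc (fins n) _ ⟩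
  ∑ (fins n) (λ x → 𝟙[ suc x Fin.≟ suc z ])       ≡⟨ ∑-cong (fins n) (λ x → 𝟙[]-⇔ (mk⇔ Fin.suc-injective (cong suc)) (suc x Fin.≟ suc z) (x Fin.≟ z)) ⟩
  count Fin._≟_ (fins n) z                        ≡⟨ fins-enumerates n z ⟩
  1                                               ∎
  where open ≡-Reasoning

vectors : {A : Set} → List A → (m : ℕ) → List (Vec A m)
vectors as zero = [] ∷ []
vectors as (suc m) = List.concatMap (λ a → map (a ∷_) (vectors as m)) as

module _ {A : Set} (_≟_ : DecidableEquality A) where

  private
    _≟ᵛ_ : {m : ℕ} → DecidableEquality (Vec A m)
    _≟ᵛ_ = Vec.≡-dec _≟_

  vectors-enumerates : (as : List A) → Enumerates _≟_ as → (m : ℕ) → Enumerates _≟ᵛ_ (vectors as m)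
  vectors-enumerates as enum zero [] = refl
  vectors-enumerates as enum (suc m) (a′ ∷ z) = begin
    count _≟ᵛ_ (vectors as (suc m)) (a′ ∷ z)
      ≡⟨ ∑-concatMap (λ a → map (a ∷_) (vectors as m)) as _ ⟩
    ∑ as (λ a → ∑ (map (a ∷_) (vectors as m)) (λ y → 𝟙[ y ≟ᵛ (a′ ∷ z) ]))
      ≡⟨ ∑-cong as (λ a → trans (∑-map (a ∷_) (vectors as m) _) (∑-cong (vectors as m) (λ y → 𝟙-∧ (does (a ≟ a′)) _))) ⟩
    ∑ as (λ a → ∑ (vectors as m) (λ y → 𝟙[ a ≟ a′ ] * 𝟙[ y ≟ᵛ z ]))
      ≡⟨ ∑-cong as (λ a → sym (*-distribˡ-∑ 𝟙[ a ≟ a′ ] (vectors as m) _)) ⟩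
    ∑ as (λ a → 𝟙[ a ≟ a′ ] * count _≟ᵛ_ (vectors as m) z)
      ≡⟨ ∑-cong as (λ a → trans (cong (𝟙[ a ≟ a′ ] *_) (vectors-enumerates as enum m z)) (*-identityʳ _)) ⟩
    count _≟_ as a′
      ≡⟨ enum a′ ⟩
    1 ∎
    where open ≡-Reasoning

_≟ˢ_ : {n : ℕ} → DecidableEquality (Subset n)
_≟ˢ_ = Vec.≡-dec Bool._≟_

allSubsets≡vectors : (n : ℕ) → allSubsets n ≡ vectors (true ∷ false ∷ []) n
allSubsets≡vectors zero = refl
allSubsets≡vectors (suc n) rewrite allSubsets≡vectors n =
  cong (map (true ∷_) (vectors bits n) ++_) (sym (List.++-identityʳ (map (false ∷_) (vectors bits n))))
  where bits = true ∷ false ∷ []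

allSubsets-enumerates : (n : ℕ) → Enumerates _≟ˢ_ (allSubsets n)
allSubsets-enumerates n = subst (Enumerates _≟ˢ_) (sym (allSubsets≡vectors n))
  (vectors-enumerates Bool._≟_ (true ∷ false ∷ []) booleans n)
  where
  booleans : Enumerates Bool._≟_ (true ∷ false ∷ [])
  booleans true = refl
  booleans false = refl

∈-allSubsets : {n : ℕ} (s : Subset n) → s ∈ₗ allSubsets n
∈-allSubsets [] = here refl
∈-allSubsets (true ∷ s) = ∈-++⁺ˡ (∈-map⁺ (true ∷_) (∈-allSubsets s))
∈-allSubsets (false ∷ s) = ∈-++⁺ʳ _ (∈-map⁺ (false ∷_) (∈-allSubsets s))

∣∣≡∑ : {n : ℕ} (s : Subset n) → ∣ s ∣ ≡ ∑ (fins n) (𝟙 ∘ lookup s)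
∣∣≡∑ [] = refl
∣∣≡∑ {suc n} (true ∷ s) = cong suc (trans (∣∣≡∑ s) (sym (∑-map suc (fins n) _)))
∣∣≡∑ {suc n} (false ∷ s) = trans (∣∣≡∑ s) (sym (∑-map suc (fins n) _))

∃-member : {n m : ℕ} (s : Subset n) → ∣ s ∣ ≡ suc m → Σ (Fin n) λ j → lookup s j ≡ true
∃-member (true ∷ s) _ = zero , refl
∃-member (false ∷ s) ∣s∣≡1+m = let (j , s[j]) = ∃-member s ∣s∣≡1+m in suc j , s[j]

-- Permutations acting on subsets

preimage : {n : ℕ} → (Fin n → Fin n) → Subset n → Subset n
preimage f s = tabulate (lookup s ∘ f)

module _ {n : ℕ} where

  lookup-preimage : (f : Fin n → Fin n) (s : Subset n) (x : Fin n) → lookup (preimage f s) x ≡ lookup s (f x)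
  lookup-preimage f s = Vec.lookup∘tabulate (lookup s ∘ f)

  preimage-∘ : (f g : Fin n → Fin n) (s : Subset n) → preimage f (preimage g s) ≡ preimage (g ∘ f) s
  preimage-∘ f g s = Vec.tabulate-cong (λ x → lookup-preimage g s (f x))

  preimage-inverse : (f g : Fin n → Fin n) → (∀ x → g (f x) ≡ x) → (s : Subset n) → preimage f (preimage g s) ≡ s
  preimage-inverse f g g∘f≗id s =
    trans (preimage-∘ f g s) (trans (Vec.tabulate-cong (cong (lookup s) ∘ g∘f≗id)) (Vec.tabulate∘lookup s))

  preimage↔ : Permutation′ n → Subset n ↔ Subset n
  preimage↔ π = mk↔ₛ′ (preimage (π ⟨$⟩ʳ_)) (preimage (π ⟨$⟩ˡ_))
    (preimage-inverse _ _ (λ _ → inverseˡ π)) (preimage-inverse _ _ (λ _ → inverseʳ π))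

  ∣preimage∣ : (π : Permutation′ n) (s : Subset n) → ∣ preimage (π ⟨$⟩ʳ_) s ∣ ≡ ∣ s ∣
  ∣preimage∣ π s = begin
    ∣ preimage (π ⟨$⟩ʳ_) s ∣                         ≡⟨ ∣∣≡∑ (preimage (π ⟨$⟩ʳ_) s) ⟩
    ∑ (fins n) (𝟙 ∘ lookup (preimage (π ⟨$⟩ʳ_) s))   ≡⟨ ∑-cong (fins n) (cong 𝟙 ∘ lookup-preimage (π ⟨$⟩ʳ_) s) ⟩
    ∑ (fins n) (𝟙 ∘ lookup s ∘ (π ⟨$⟩ʳ_))            ≡⟨ ∑-reindex Fin._≟_ (fins n) π (fins-enumerates n) (𝟙 ∘ lookup s) ⟩
    ∑ (fins n) (𝟙 ∘ lookup s)                        ≡⟨ sym (∣∣≡∑ s) ⟩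
    ∣ s ∣                                            ∎
    where open ≡-Reasoning

  preimage-flip : (π : Permutation′ n) {s t : Subset n} → preimage (π ⟨$⟩ʳ_) s ≡ t → preimage (π ⟨$⟩ˡ_) t ≡ s
  preimage-flip π {s} refl = preimage-inverse _ _ (λ _ → inverseʳ π) s

mutual

  preimage-transitive : {n : ℕ} (s t : Subset n) → ∣ s ∣ ≡ ∣ t ∣ →
    Σ (Permutation′ n) λ π → preimage (π ⟨$⟩ʳ_) s ≡ t
  preimage-transitive [] [] _ = Perm.id , refl
  preimage-transitive (true ∷ s) (true ∷ t) ∣s∣≡∣t∣ =
    let (π , s↦t) = preimage-transitive s t (suc-injective ∣s∣≡∣t∣) in lift₀ π , cong (true ∷_) s↦t
  preimage-transitive (false ∷ s) (false ∷ t) ∣s∣≡∣t∣ =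
    let (π , s↦t) = preimage-transitive s t ∣s∣≡∣t∣ in lift₀ π , cong (false ∷_) s↦t
  preimage-transitive (true ∷ s) (false ∷ t) ∣s∣≡∣t∣ = preimage-transitive-true-false s t ∣s∣≡∣t∣
  preimage-transitive (false ∷ s) (true ∷ t) ∣s∣≡∣t∣ =
    let (π , t↦s) = preimage-transitive-true-false t s (sym ∣s∣≡∣t∣) in Perm.flip π , preimage-flip π t↦s

  -- Transposing 0 with a vertex of t reduces this case to one with equal heads.
  preimage-transitive-true-false : {n : ℕ} (s t : Subset n) → suc ∣ s ∣ ≡ ∣ t ∣ →
    Σ (Permutation′ (suc n)) λ π → preimage (π ⟨$⟩ʳ_) (true ∷ s) ≡ false ∷ t
  preimage-transitive-true-false {n} s t 1+∣s∣≡∣t∣ =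
    let (π , s↦tail) = preimage-transitive s (Vec.tail u) ∣s∣≡∣tail∣
    in Perm.flip τ ∘ₚ lift₀ π , (begin
      preimage (λ x → lift₀ π ⟨$⟩ʳ (τ ⟨$⟩ˡ x)) (true ∷ s)   ≡⟨ preimage-∘ (τ ⟨$⟩ˡ_) (lift₀ π ⟨$⟩ʳ_) (true ∷ s) ⟨
      preimage (τ ⟨$⟩ˡ_) (true ∷ preimage (π ⟨$⟩ʳ_) s)      ≡⟨ cong (preimage (τ ⟨$⟩ˡ_) ∘ (true ∷_)) s↦tail ⟩
      preimage (τ ⟨$⟩ˡ_) (true ∷ Vec.tail u)                 ≡⟨ preimage-flip τ u≡true∷tail ⟩
      false ∷ t                                              ∎)
    where
    open ≡-Reasoning
    member : Σ (Fin n) λ j → lookup t j ≡ true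
    member = ∃-member t (sym 1+∣s∣≡∣t∣)
    τ : Permutation′ (suc n)
    τ = Perm.transpose zero (suc (proj₁ member))
    u : Subset (suc n)
    u = preimage (τ ⟨$⟩ʳ_) (false ∷ t)
    u≡true∷tail : u ≡ true ∷ Vec.tail u
    u≡true∷tail = cong (_∷ Vec.tail u) (proj₂ member)
    ∣s∣≡∣tail∣ : ∣ s ∣ ≡ ∣ Vec.tail u ∣
    ∣s∣≡∣tail∣ = suc-injective (trans 1+∣s∣≡∣t∣ (trans (sym (∣preimage∣ τ (false ∷ t))) (cong ∣_∣ u≡true∷tail)))

-- Counting relabellings of an r-graph

injective? : {n m : ℕ} (f : Fin n → Fin m) → Dec (Injective _≡_ _≡_ f)
injective? f = map′ (λ inj {x} {y} → inj x y) (λ inj x y → inj)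
  (Fin.all? λ x → Fin.all? λ y → (f x Fin.≟ f y) →-dec (x Fin.≟ y))

injective⇒surjective : {n : ℕ} (f : Fin n → Fin n) → Injective _≡_ _≡_ f → ∀ y → Σ (Fin n) λ x → f x ≡ y
injective⇒surjective {suc n} f f-inj y with Fin.any? (λ x → f x Fin.≟ y)
... | yes hit = hit
... | no miss = ⊥-elim (<-irrefl refl (Fin.injective⇒≤ shrink-injective))
  where
  f≢y : ∀ x → y ≢ f x
  f≢y x y≡fx = miss (x , sym y≡fx)
  shrink : Fin (suc n) → Fin n
  shrink x = Fin.punchOut (f≢y x)
  shrink-injective : Injective _≡_ _≡_ shrink
  shrink-injective = f-inj ∘ Fin.punchOut-injective (f≢y _) (f≢y _)

injective⇒permutation : {n : ℕ} (f : Fin n → Fin n) → Injective _≡_ _≡_ f → Permutation′ n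
injective⇒permutation f f-inj = Perm.permutation f (proj₁ ∘ surj)
  (proj₂ ∘ surj) (λ x → f-inj (proj₂ (surj (f x))))
  where surj = injective⇒surjective f f-inj

-- A permutation of Fin n is represented by its table of values; sums over permutations
-- run over all tables, weighted by the indicator of injectivity.
tables : (n : ℕ) → List (Vec (Fin n) n)
tables n = vectors (fins n) n

tables-enumerates : (n : ℕ) → Enumerates (Vec.≡-dec Fin._≟_) (tables n)
tables-enumerates n = vectors-enumerates Fin._≟_ (fins n) (fins-enumerates n) n

𝟙-permutation : {n : ℕ} → Vec (Fin n) n → ℕ
𝟙-permutation v = 𝟙[ injective? (lookup v) ]

#permutations : ℕ → ℕ
#permutations n = ∑ (tables n) 𝟙-permutation

module _ {n : ℕ} (π : Permutation′ n) where

  map↔ : {m : ℕ} → Vec (Fin n) m ↔ Vec (Fin n) m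
  map↔ = mk↔ₛ′ (Vec.map (π ⟨$⟩ʳ_)) (Vec.map (π ⟨$⟩ˡ_)) (map-inverse (λ _ → inverseʳ π)) (map-inverse (λ _ → inverseˡ π))
    where
    map-inverse : {m : ℕ} {f g : Fin n → Fin n} → (∀ x → f (g x) ≡ x) → (v : Vec (Fin n) m) → Vec.map f (Vec.map g v) ≡ v
    map-inverse {f = f} {g} f∘g≗id v =
      trans (sym (Vec.map-∘ f g v)) (trans (Vec.map-cong f∘g≗id v) (Vec.map-id v))

  π-injective : Injective _≡_ _≡_ (π ⟨$⟩ʳ_)
  π-injective {x} {y} πx≡πy = trans (sym (inverseˡ π)) (trans (cong (π ⟨$⟩ˡ_) πx≡πy) (inverseˡ π))

  𝟙-permutation-map : (v : Vec (Fin n) n) → 𝟙-permutation (Vec.map (π ⟨$⟩ʳ_) v) ≡ 𝟙-permutation v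
  𝟙-permutation-map v = 𝟙[]-⇔ (mk⇔ injective-map⇒injective injective⇒injective-map)
    (injective? (lookup (Vec.map (π ⟨$⟩ʳ_) v))) (injective? (lookup v))
    where
    lookup-π : ∀ x → lookup (Vec.map (π ⟨$⟩ʳ_) v) x ≡ π ⟨$⟩ʳ lookup v x
    lookup-π x = Vec.lookup-map x (π ⟨$⟩ʳ_) v
    injective-map⇒injective : Injective _≡_ _≡_ (lookup (Vec.map (π ⟨$⟩ʳ_) v)) → Injective _≡_ _≡_ (lookup v)
    injective-map⇒injective inj {x} {y} vx≡vy = inj (trans (lookup-π x) (trans (cong (π ⟨$⟩ʳ_) vx≡vy) (sym (lookup-π y))))
    injective⇒injective-map : Injective _≡_ _≡_ (lookup v) → Injective _≡_ _≡_ (lookup (Vec.map (π ⟨$⟩ʳ_) v))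
    injective⇒injective-map inj {x} {y} e = inj (π-injective (trans (sym (lookup-π x)) (trans e (lookup-π y))))

relabel : {n : ℕ} → (Fin n → Fin n) → RGraph n → RGraph n
relabel f G = G ∘ preimage f

#covering : {n : ℕ} → RGraph n → Subset n → ℕ
#covering {n} G e = ∑ (tables n) (λ v → 𝟙-permutation v * 𝟙 (relabel (lookup v) G e))

#covering-preimage : {n : ℕ} (G : RGraph n) (π : Permutation′ n) (e : Subset n) →
  #covering G (preimage (π ⟨$⟩ʳ_) e) ≡ #covering G e
#covering-preimage {n} G π e = trans (∑-cong (tables n) term≡) (∑-reindex (Vec.≡-dec Fin._≟_) (tables n) (map↔ π) (tables-enumerates n) term)
  where
  term : Vec (Fin n) n → ℕ
  term v = 𝟙-permutation v * 𝟙 (relabel (lookup v) G e)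
  term≡ : ∀ v → 𝟙-permutation v * 𝟙 (relabel (lookup v) G (preimage (π ⟨$⟩ʳ_) e)) ≡ term (Vec.map (π ⟨$⟩ʳ_) v)
  term≡ v = cong₂ _*_ (sym (𝟙-permutation-map π v)) (cong (𝟙 ∘ G) (begin
    preimage (lookup v) (preimage (π ⟨$⟩ʳ_) e)    ≡⟨ preimage-∘ (lookup v) (π ⟨$⟩ʳ_) e ⟩
    preimage ((π ⟨$⟩ʳ_) ∘ lookup v) e             ≡⟨ Vec.tabulate-cong (λ x → cong (lookup e) (sym (Vec.lookup-map x (π ⟨$⟩ʳ_) v))) ⟩
    preimage (lookup (Vec.map (π ⟨$⟩ʳ_) v)) e     ∎))
    where open ≡-Reasoning

#covering-∣∣ : {n : ℕ} (G : RGraph n) (e e′ : Subset n) → ∣ e ∣ ≡ ∣ e′ ∣ → #covering G e ≡ #covering G e′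
#covering-∣∣ G e e′ ∣e∣≡∣e′∣ =
  let (π , e↦e′) = preimage-transitive e e′ ∣e∣≡∣e′∣ in trans (sym (#covering-preimage G π e)) (cong (#covering G) e↦e′)

edges : (r : ℕ) {n : ℕ} → RGraph n → ℕ
edges r {n} G = ∑ (allSubsets n) (λ s → 𝟙 (does (∣ s ∣ ℕ.≟ r) ∧ G s))

#rSets : (r n : ℕ) → ℕ
#rSets r n = ∑ (allSubsets n) (λ s → 𝟙[ ∣ s ∣ ℕ.≟ r ])

length-filter≡∑ : {A : Set} (p : A → Bool) (xs : List A) → List.length (List.filter (T? ∘ p) xs) ≡ ∑ xs (𝟙 ∘ p)
length-filter≡∑ p [] = refl
length-filter≡∑ p (x ∷ xs) with p x
... | true = cong suc (length-filter≡∑ p xs)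
... | false = length-filter≡∑ p xs

edgeCount≡edges : (r : ℕ) {n : ℕ} (G : RGraph n) → edgeCount r G ≡ edges r G
edgeCount≡edges r {n} G = length-filter≡∑ (λ s → (∣ s ∣ ℕ.≡ᵇ r) ∧ G s) (allSubsets n)

#rSets≡C : (r n : ℕ) → #rSets r n ≡ n C r
#rSets≡C zero zero = refl
#rSets≡C (suc r) zero = refl
#rSets≡C zero (suc n) = begin
  ∑ (map (true ∷_) S ++ map (false ∷_) S) (λ s → 𝟙[ ∣ s ∣ ℕ.≟ 0 ])   ≡⟨ ∑-++ (map (true ∷_) S) _ _ ⟩
  ∑ (map (true ∷_) S) _ + ∑ (map (false ∷_) S) _                 ≡⟨ cong₂ _+_ (trans (∑-map (true ∷_) S _) (∑-zero S))
                                                                              (trans (∑-map (false ∷_) S _) (#rSets≡C 0 n)) ⟩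
  1                                                             ∎
  where
  open ≡-Reasoning
  S : List (Subset n)
  S = allSubsets n
#rSets≡C (suc r) (suc n) = begin
  ∑ (map (true ∷_) S ++ map (false ∷_) S) (λ s → 𝟙[ ∣ s ∣ ℕ.≟ suc r ])   ≡⟨ ∑-++ (map (true ∷_) S) _ _ ⟩
  ∑ (map (true ∷_) S) _ + ∑ (map (false ∷_) S) _                     ≡⟨ cong₂ _+_ (trans (∑-map (true ∷_) S _) (#rSets≡C r n))
                                                                                  (trans (∑-map (false ∷_) S _) (#rSets≡C (suc r) n)) ⟩
  n C r + n C suc r                                                  ≡⟨ nCk+nC[k+1]≡[n+1]C[k+1] n r ⟩
  suc n C suc r                                                      ∎
  where
  open ≡-Reasoning
  S : List (Subset n)
  S = allSubsets n

C≤^ : (n r : ℕ) → n C r ≤ n ^ r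
C≤^ n zero = ≤-refl
C≤^ zero (suc r) = z≤n
C≤^ (suc n) (suc r) = begin
  suc n C suc r       ≡⟨ sym (nCk+nC[k+1]≡[n+1]C[k+1] n r) ⟩
  n C r + n C suc r   ≤⟨ +-mono-≤ (C≤^ n r) (C≤^ n (suc r)) ⟩
  n ^ r + n * n ^ r   ≤⟨ +-mono-≤ (^-monoˡ-≤ r (n≤1+n n)) (*-monoʳ-≤ n (^-monoˡ-≤ r (n≤1+n n))) ⟩
  suc n ^ suc r       ∎
  where open ≤-Reasoning

edges-relabel : (r : ℕ) {n : ℕ} (G : RGraph n) (π : Permutation′ n) → edges r (relabel (π ⟨$⟩ʳ_) G) ≡ edges r G
edges-relabel r {n} G π = begin
  ∑ (allSubsets n) (λ s → 𝟙 (does (∣ s ∣ ℕ.≟ r) ∧ G (preimage (π ⟨$⟩ʳ_) s)))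
    ≡⟨ ∑-cong (allSubsets n) (λ s → cong (λ m → 𝟙 (does (m ℕ.≟ r) ∧ G (preimage (π ⟨$⟩ʳ_) s))) (sym (∣preimage∣ π s))) ⟩
  ∑ (allSubsets n) (term ∘ preimage (π ⟨$⟩ʳ_))
    ≡⟨ ∑-reindex _≟ˢ_ (allSubsets n) (preimage↔ π) (allSubsets-enumerates n) term ⟩
  edges r G ∎
  where
  open ≡-Reasoning
  term : Subset n → ℕ
  term s = 𝟙 (does (∣ s ∣ ℕ.≟ r) ∧ G s)

double-counting : (r : ℕ) {n : ℕ} (G : RGraph n) (e : Subset n) → ∣ e ∣ ≡ r →
  #rSets r n * #covering G e ≡ #permutations n * edges r G
double-counting r {n} G e ∣e∣≡r = begin
  #rSets r n * #covering G e
    ≡⟨ *-distribʳ-∑ (#covering G e) (allSubsets n) _ ⟩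
  ∑ S (λ s → 𝟙[ ∣ s ∣ ℕ.≟ r ] * #covering G e)
    ≡⟨ ∑-cong S (λ s → 𝟙[]*-cong (∣ s ∣ ℕ.≟ r) (λ ∣s∣≡r → #covering-∣∣ G e s (trans ∣e∣≡r (sym ∣s∣≡r)))) ⟩
  ∑ S (λ s → 𝟙[ ∣ s ∣ ℕ.≟ r ] * #covering G s)
    ≡⟨ ∑-cong S (λ s → *-distribˡ-∑ 𝟙[ ∣ s ∣ ℕ.≟ r ] (tables n) _) ⟩
  ∑ S (λ s → ∑ (tables n) (λ v → 𝟙[ ∣ s ∣ ℕ.≟ r ] * (𝟙-permutation v * 𝟙 (relabel (lookup v) G s))))
    ≡⟨ ∑-comm S (tables n) _ ⟩
  ∑ (tables n) (λ v → ∑ S (λ s → 𝟙[ ∣ s ∣ ℕ.≟ r ] * (𝟙-permutation v * 𝟙 (relabel (lookup v) G s))))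
    ≡⟨ ∑-cong (tables n) (λ v → ∑-cong S (λ s → trans (x∙yz≈y∙xz 𝟙[ ∣ s ∣ ℕ.≟ r ] (𝟙-permutation v) (𝟙 (relabel (lookup v) G s)))
                                                  (cong (𝟙-permutation v *_) (sym (𝟙-∧ (does (∣ s ∣ ℕ.≟ r)) (relabel (lookup v) G s)))))) ⟩
  ∑ (tables n) (λ v → ∑ S (λ s → 𝟙-permutation v * 𝟙 (does (∣ s ∣ ℕ.≟ r) ∧ relabel (lookup v) G s)))
    ≡⟨ ∑-cong (tables n) (λ v → sym (*-distribˡ-∑ (𝟙-permutation v) S _)) ⟩
  ∑ (tables n) (λ v → 𝟙-permutation v * edges r (relabel (lookup v) G))
    ≡⟨ ∑-cong (tables n) (λ v → 𝟙[]*-cong (injective? (lookup v))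
                                   (λ inj → edges-relabel r G (injective⇒permutation (lookup v) inj))) ⟩
  ∑ (tables n) (λ v → 𝟙-permutation v * edges r G)
    ≡⟨ sym (*-distribʳ-∑ (edges r G) (tables n) 𝟙-permutation) ⟩
  #permutations n * edges r G ∎
  where
  open ≡-Reasoning
  S : List (Subset n)
  S = allSubsets n

module _ {n : ℕ} {y : Fin n} {t : Subset n} where

  ∈-preimage⁻ : (f : Fin n → Fin n) → y ∈ preimage f t → f y ∈ t
  ∈-preimage⁻ f y∈ = Vec.lookup⇒[]= (f y) t (trans (sym (lookup-preimage f t y)) (Vec.[]=⇒lookup y∈))

  ∈-preimage⁺ : (f : Fin n → Fin n) → f y ∈ t → y ∈ preimage f t
  ∈-preimage⁺ f fy∈ = Vec.lookup⇒[]= y (preimage f t) (trans (lookup-preimage f t y) (Vec.[]=⇒lookup fy∈))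

ImageOf-preimage : {v n : ℕ} (π : Permutation′ n) {φ : Fin v → Fin n} {s : Subset v} {t : Subset n} →
  ImageOf φ s t → ImageOf ((π ⟨$⟩ˡ_) ∘ φ) s (preimage (π ⟨$⟩ʳ_) t)
ImageOf-preimage π {φ} {s} {t} image y = to , from
  where
  to : y ∈ preimage (π ⟨$⟩ʳ_) t → Σ (Fin _) λ x → (x ∈ s) × (π ⟨$⟩ˡ φ x ≡ y)
  to y∈ = let (x , x∈s , φx≡πy) = proj₁ (image (π ⟨$⟩ʳ y)) (∈-preimage⁻ (π ⟨$⟩ʳ_) y∈)
          in x , x∈s , trans (cong (π ⟨$⟩ˡ_) φx≡πy) (inverseˡ π)
  from : Σ (Fin _) (λ x → (x ∈ s) × (π ⟨$⟩ˡ φ x ≡ y)) → y ∈ preimage (π ⟨$⟩ʳ_) t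
  from (x , x∈s , refl) = ∈-preimage⁺ (π ⟨$⟩ʳ_) (subst (_∈ t) (sym (inverseʳ π)) (proj₂ (image (φ x)) (x , x∈s , refl)))

ContainsCopy-relabel : (r : ℕ) {v n : ℕ} (H : RGraph v) (G : RGraph n) (π : Permutation′ n) →
  ContainsCopy r H (relabel (π ⟨$⟩ʳ_) G) → ContainsCopy r H G
ContainsCopy-relabel r H G π (φ , φ-inj , copy) = (π ⟨$⟩ˡ_) ∘ φ , φ-inj ∘ π⁻¹-injective , copy′
  where
  π⁻¹-injective : Injective _≡_ _≡_ (π ⟨$⟩ˡ_)
  π⁻¹-injective = π-injective (Perm.flip π)
  copy′ : ∀ s → IsEdge r H s → Σ (Subset _) λ t → ImageOf ((π ⟨$⟩ˡ_) ∘ φ) s t × IsEdge r G t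
  copy′ s s∈H = let (t , image , ∣t∣≡r , t∈G) = copy s s∈H
                in preimage (π ⟨$⟩ʳ_) t , ImageOf-preimage π image , trans (∣preimage∣ π t) ∣t∣≡r , t∈G

-- Derandomised covering

module Derandomisation {r n k : ℕ} (G : RGraph n) (L : Subset n → Fin k → ℕ)
  (L-injective : ∀ e → ∣ e ∣ ≡ r → Injective _≡_ _≡_ (L e)) (N>0 : 0 < #rSets r n) where

  N M ex : ℕ
  N = #rSets r n
  M = #permutations n
  ex = edges r G

  weight : List ℕ → ℕ → ℕ
  weight cs c = if does (c ∈? cs) then N ∸ ex else N

  -- N ^ k times the expected number of r-sets of U left uncovered when every colour of cs
  -- receives an independent uniformly random relabelling of G.
  potential : List ℕ → (Subset n → Bool) → ℕ
  potential cs U = ∑ (allSubsets n) (λ e → 𝟙[ ∣ e ∣ ℕ.≟ r ] * (𝟙 (U e) * ∏ k (weight cs ∘ L e)))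

  Covered : List ℕ → (Subset n → Bool) → (ℕ → Permutation′ n) → Set
  Covered cs U σ = ∀ e → ∣ e ∣ ≡ r → U e ≡ true →
    Σ (Fin k) λ i → L e i ∈ₗ cs × relabel (σ (L e i) ⟨$⟩ʳ_) G e ≡ true

  CoveredBy : ℕ → Vec (Fin n) n → Subset n → Set
  CoveredBy c v e = (Σ (Fin k) λ i → L e i ≡ c) × T (relabel (lookup v) G e)

  coveredBy? : ∀ c v e → Dec (CoveredBy c v e)
  coveredBy? c v e = Fin.any? (λ i → L e i ℕ.≟ c) ×-dec T? (relabel (lookup v) G e)

  uncoveredBy : ℕ → Vec (Fin n) n → (Subset n → Bool) → Subset n → Bool
  uncoveredBy c v U e = U e ∧ not (does (coveredBy? c v e))

  weight-∉ : (cs : List ℕ) (x : ℕ) → x ∉ₗ cs → weight cs x ≡ N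
  weight-∉ cs x x∉cs = cong (if_then N ∸ ex else N) (dec-false (x ∈? cs) x∉cs)

  weight-∈ : (cs : List ℕ) (x : ℕ) → x ∈ₗ cs → weight cs x ≡ N ∸ ex
  weight-∈ cs x x∈cs = cong (if_then N ∸ ex else N) (dec-true (x ∈? cs) x∈cs)

  weight-∷ : (c : ℕ) (cs : List ℕ) (x : ℕ) → (x ≡ c → x ∈ₗ cs) → weight (c ∷ cs) x ≡ weight cs x
  weight-∷ c cs x x≡c⇒x∈cs = cong (if_then N ∸ ex else N) (does-⇔ (mk⇔ drop-head there) (x ∈? (c ∷ cs)) (x ∈? cs))
    where
    drop-head : x ∈ₗ c ∷ cs → x ∈ₗ cs
    drop-head (here x≡c) = x≡c⇒x∈cs x≡c
    drop-head (there x∈cs) = x∈cs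

  -- By double counting, an r-set is missed by a random relabelling with probability (N ∸ ex) / N.
  misses : (e : Subset n) → ∣ e ∣ ≡ r →
    ∑ (tables n) (λ v → 𝟙-permutation v * 𝟙 (not (relabel (lookup v) G e))) * N ≡ M * (N ∸ ex)
  misses e ∣e∣≡r = begin
    missed * N                     ≡⟨ cong (_* N) (m+n∸n≡m missed (#covering G e)) ⟨
    (missed + hits ∸ hits) * N     ≡⟨ cong (λ m → (m ∸ hits) * N) missed+hits≡M ⟩
    (M ∸ hits) * N                 ≡⟨ *-distribʳ-∸ N M hits ⟩
    M * N ∸ hits * N               ≡⟨ cong (M * N ∸_) (trans (*-comm hits N) (double-counting r G e ∣e∣≡r)) ⟩
    M * N ∸ M * ex                 ≡⟨ *-distribˡ-∸ M N ex ⟨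
    M * (N ∸ ex)                   ∎
    where
    open ≡-Reasoning
    missed hits : ℕ
    missed = ∑ (tables n) (λ v → 𝟙-permutation v * 𝟙 (not (relabel (lookup v) G e)))
    hits = #covering G e
    missed+hits≡M : missed + hits ≡ M
    missed+hits≡M = trans (sym (∑-+ (tables n) _ _)) (∑-cong (tables n) λ v →
      trans (sym (*-distribˡ-+ (𝟙-permutation v) _ _)) (trans (cong (𝟙-permutation v *_) (𝟙-not (relabel (lookup v) G e))) (*-identityʳ _)))

  weight-step : {c : ℕ} {cs : List ℕ} → c ∉ₗ cs → (e : Subset n) → ∣ e ∣ ≡ r → (i : Fin k) → L e i ≡ c →
    ∏ k (weight (c ∷ cs) ∘ L e) * N ≡ ∏ k (weight cs ∘ L e) * (N ∸ ex)
  weight-step {c} {cs} c∉cs e ∣e∣≡r i Lei≡c = begin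
    ∏ k (weight (c ∷ cs) ∘ L e) * N                   ≡⟨ cong (∏ k (weight (c ∷ cs) ∘ L e) *_) (weight-∉ cs (L e i) (c∉cs ∘ subst (_∈ₗ cs) Lei≡c)) ⟨
    ∏ k (weight (c ∷ cs) ∘ L e) * weight cs (L e i)   ≡⟨ ∏-exchange k _ _ i (λ j j≢i → weight-∷ c cs (L e j) (⊥-elim ∘ j≢i ∘ Lej≡c⇒j≡i j)) ⟩
    ∏ k (weight cs ∘ L e) * weight (c ∷ cs) (L e i)   ≡⟨ cong (∏ k (weight cs ∘ L e) *_) (weight-∈ (c ∷ cs) (L e i) (here Lei≡c)) ⟩
    ∏ k (weight cs ∘ L e) * (N ∸ ex)                  ∎
    where
    open ≡-Reasoning
    Lej≡c⇒j≡i : ∀ j → L e j ≡ c → j ≡ i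
    Lej≡c⇒j≡i j Lej≡c = L-injective e ∣e∣≡r (trans Lej≡c (sym Lei≡c))

  potential-term-step : {c : ℕ} {cs : List ℕ} → c ∉ₗ cs → (e : Subset n) → ∣ e ∣ ≡ r →
    (colour? : Dec (Σ (Fin k) λ i → L e i ≡ c)) →
    ∑ (tables n) (λ v → 𝟙-permutation v * 𝟙 (not (does colour? ∧ relabel (lookup v) G e))) * (N * ∏ k (weight cs ∘ L e))
      ≡ M * (N * ∏ k (weight (c ∷ cs) ∘ L e))
  potential-term-step {c} {cs} c∉cs e ∣e∣≡r (no no-c) = cong₂ _*_
    (∑-cong (tables n) (*-identityʳ ∘ 𝟙-permutation))
    (cong (N *_) (∏-cong k (λ i → sym (weight-∷ c cs (L e i) (⊥-elim ∘ no-c ∘ (i ,_))))))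
  potential-term-step {c} {cs} c∉cs e ∣e∣≡r (yes (i , Lei≡c)) = begin
    missed * (N * W)           ≡⟨ *-assoc missed N W ⟨
    missed * N * W             ≡⟨ cong (_* W) (misses e ∣e∣≡r) ⟩
    M * (N ∸ ex) * W           ≡⟨ rearrange M (N ∸ ex) W ⟩
    M * (W * (N ∸ ex))         ≡⟨ cong (M *_) (weight-step c∉cs e ∣e∣≡r i Lei≡c) ⟨
    M * (W′ * N)               ≡⟨ cong (M *_) (*-comm W′ N) ⟩
    M * (N * W′)               ∎
    where
    open ≡-Reasoning
    missed W W′ : ℕ
    missed = ∑ (tables n) (λ v → 𝟙-permutation v * 𝟙 (not (relabel (lookup v) G e)))
    W = ∏ k (weight cs ∘ L e)
    W′ = ∏ k (weight (c ∷ cs) ∘ L e)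
    rearrange : ∀ a b c → a * b * c ≡ a * (c * b)
    rearrange = solve-∀

  potential-term-average : {c : ℕ} {cs : List ℕ} → c ∉ₗ cs → (U : Subset n → Bool) (e : Subset n) →
    ∑ (tables n) (λ v → N * (𝟙-permutation v * (𝟙[ ∣ e ∣ ℕ.≟ r ] * (𝟙 (uncoveredBy c v U e) * ∏ k (weight cs ∘ L e)))))
      ≡ N * (M * (𝟙[ ∣ e ∣ ℕ.≟ r ] * (𝟙 (U e) * ∏ k (weight (c ∷ cs) ∘ L e))))
  potential-term-average {c} {cs} c∉cs U e = begin
    ∑ Ts (λ v → N * (𝟙-permutation v * (ρ * (𝟙 (uncoveredBy c v U e) * W))))
      ≡⟨ ∑-cong Ts (λ v → trans (cong (λ x → N * (𝟙-permutation v * (ρ * (x * W)))) (𝟙-∧ (U e) _))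
                               (rearrange₁ N (𝟙-permutation v) ρ (𝟙 (U e)) _ W)) ⟩
    ∑ Ts (λ v → ρ * (𝟙 (U e) * (𝟙-permutation v * 𝟙 (not (does (coveredBy? c v e))) * (N * W))))
      ≡⟨ trans (sym (*-distribˡ-∑ ρ Ts _)) (cong (ρ *_) (trans (sym (*-distribˡ-∑ (𝟙 (U e)) Ts _))
           (cong (𝟙 (U e) *_) (sym (*-distribʳ-∑ (N * W) Ts _))))) ⟩
    ρ * (𝟙 (U e) * (∑ Ts (λ v → 𝟙-permutation v * 𝟙 (not (does (coveredBy? c v e)))) * (N * W)))
      ≡⟨ 𝟙[]*-cong (∣ e ∣ ℕ.≟ r) (λ ∣e∣≡r → cong (𝟙 (U e) *_)
           (potential-term-step c∉cs e ∣e∣≡r (Fin.any? (λ i → L e i ℕ.≟ c)))) ⟩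
    ρ * (𝟙 (U e) * (M * (N * W′)))
      ≡⟨ rearrange₂ ρ (𝟙 (U e)) M N W′ ⟩
    N * (M * (ρ * (𝟙 (U e) * W′))) ∎
    where
    open ≡-Reasoning
    Ts : List (Vec (Fin n) n)
    Ts = tables n
    ρ W W′ : ℕ
    ρ = 𝟙[ ∣ e ∣ ℕ.≟ r ]
    W = ∏ k (weight cs ∘ L e)
    W′ = ∏ k (weight (c ∷ cs) ∘ L e)
    rearrange₁ : ∀ N p ρ u x w → N * (p * (ρ * (u * x * w))) ≡ ρ * (u * (p * x * (N * w)))
    rearrange₁ = solve-∀
    rearrange₂ : ∀ ρ u M N w → ρ * (u * (M * (N * w))) ≡ N * (M * (ρ * (u * w)))
    rearrange₂ = solve-∀

  potential-average : {c : ℕ} {cs : List ℕ} → c ∉ₗ cs → (U : Subset n → Bool) →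
    ∑ (tables n) (λ v → 𝟙-permutation v * potential cs (uncoveredBy c v U)) ≡ M * potential (c ∷ cs) U
  potential-average {c} {cs} c∉cs U = *-cancelˡ-≡ _ _ N {{ℕ.>-nonZero N>0}} (begin
    N * ∑ Ts (λ v → 𝟙-permutation v * potential cs (uncoveredBy c v U))
      ≡⟨ trans (*-distribˡ-∑ N Ts _) (∑-cong Ts (λ v → trans (cong (N *_) (*-distribˡ-∑ (𝟙-permutation v) S _)) (*-distribˡ-∑ N S _))) ⟩
    ∑ Ts (λ v → ∑ S (λ e → N * (𝟙-permutation v * (𝟙[ ∣ e ∣ ℕ.≟ r ] * (𝟙 (uncoveredBy c v U e) * W cs e)))))
      ≡⟨ ∑-comm Ts S _ ⟩
    ∑ S (λ e → ∑ Ts (λ v → N * (𝟙-permutation v * (𝟙[ ∣ e ∣ ℕ.≟ r ] * (𝟙 (uncoveredBy c v U e) * W cs e)))))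
      ≡⟨ ∑-cong S (potential-term-average c∉cs U) ⟩
    ∑ S (λ e → N * (M * (𝟙[ ∣ e ∣ ℕ.≟ r ] * (𝟙 (U e) * W (c ∷ cs) e))))
      ≡⟨ trans (sym (*-distribˡ-∑ N S _)) (cong (N *_) (sym (*-distribˡ-∑ M S _))) ⟩
    N * (M * potential (c ∷ cs) U) ∎)
    where
    open ≡-Reasoning
    Ts : List (Vec (Fin n) n)
    Ts = tables n
    S : List (Subset n)
    S = allSubsets n
    W : List ℕ → Subset n → ℕ
    W cs e = ∏ k (weight cs ∘ L e)

  M>0 : 0 < M
  M>0 = begin-strict
    0                                     <⟨ ℕ.z<s ⟩
    1                                     ≡⟨ 𝟙[]-yes (injective? (lookup identity)) identity-injective ⟨
    𝟙-permutation identity                ≤⟨ term≤∑ (Vec.≡-dec Fin._≟_) (tables n) (tables-enumerates n) 𝟙-permutation identity ⟩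
    M                                     ∎
    where
    open ≤-Reasoning
    identity : Vec (Fin n) n
    identity = tabulate id
    identity-injective : Injective _≡_ _≡_ (lookup identity)
    identity-injective {x} {y} eq = trans (sym (Vec.lookup∘tabulate id x)) (trans eq (Vec.lookup∘tabulate id y))

  ∃-good-table : {c : ℕ} {cs : List ℕ} → c ∉ₗ cs → (U : Subset n → Bool) → potential (c ∷ cs) U < N ^ k →
    Σ (Vec (Fin n) n) λ v → Injective _≡_ _≡_ (lookup v) × potential cs (uncoveredBy c v U) < N ^ k
  ∃-good-table {c} {cs} c∉cs U small =
    ∃-below-average (injective? ∘ lookup) (tables n) (λ v → potential cs (uncoveredBy c v U)) (N ^ k) (begin-strict
      ∑ (tables n) (λ v → 𝟙-permutation v * potential cs (uncoveredBy c v U))   ≡⟨ potential-average c∉cs U ⟩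
      M * potential (c ∷ cs) U                                                  <⟨ *-monoʳ-< M {{ℕ.>-nonZero M>0}} small ⟩
      M * N ^ k                                                                 ∎)
    where open ≤-Reasoning

  potential-∷-∈ : {c : ℕ} {cs : List ℕ} → c ∈ₗ cs → (U : Subset n → Bool) → potential (c ∷ cs) U ≡ potential cs U
  potential-∷-∈ {c} {cs} c∈cs U = ∑-cong (allSubsets n) λ e → cong (λ w → 𝟙[ ∣ e ∣ ℕ.≟ r ] * (𝟙 (U e) * w))
    (∏-cong k λ i → weight-∷ c cs (L e i) λ Lei≡c → subst (_∈ₗ cs) (sym Lei≡c) c∈cs)

  N^k≤potential-[] : (U : Subset n → Bool) (e : Subset n) → ∣ e ∣ ≡ r → U e ≡ true → N ^ k ≤ potential [] U
  N^k≤potential-[] U e ∣e∣≡r Ue = begin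
    N ^ k                                           ≡⟨ ∏-const k N ⟨
    ∏ k (weight [] ∘ L e)                           ≡⟨ *-identityˡ _ ⟨
    1 * ∏ k (weight [] ∘ L e)                       ≡⟨ cong (λ b → 𝟙 b * ∏ k (weight [] ∘ L e)) Ue ⟨
    𝟙 (U e) * ∏ k (weight [] ∘ L e)                 ≡⟨ *-identityˡ _ ⟨
    1 * (𝟙 (U e) * ∏ k (weight [] ∘ L e))           ≡⟨ cong (_* (𝟙 (U e) * ∏ k (weight [] ∘ L e))) (𝟙[]-yes (∣ e ∣ ℕ.≟ r) ∣e∣≡r) ⟨
    𝟙[ ∣ e ∣ ℕ.≟ r ] * (𝟙 (U e) * ∏ k (weight [] ∘ L e))
      ≤⟨ term≤∑ _≟ˢ_ (allSubsets n) (allSubsets-enumerates n) (λ e → 𝟙[ ∣ e ∣ ℕ.≟ r ] * (𝟙 (U e) * ∏ k (weight [] ∘ L e))) e ⟩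
    potential [] U                                  ∎
    where open ≤-Reasoning

  Covered-extend : {c : ℕ} {cs : List ℕ} → c ∉ₗ cs → (U : Subset n → Bool) (v : Vec (Fin n) n) →
    Injective _≡_ _≡_ (lookup v) → Σ (ℕ → Permutation′ n) (Covered cs (uncoveredBy c v U)) →
    Σ (ℕ → Permutation′ n) (Covered (c ∷ cs) U)
  Covered-extend {c} {cs} c∉cs U v v-injective (σ′ , covered′) = σ , covered
    where
    πᵥ : Permutation′ n
    πᵥ = injective⇒permutation (lookup v) v-injective
    σ : ℕ → Permutation′ n
    σ x = if does (x ℕ.≟ c) then πᵥ else σ′ x
    covered : Covered (c ∷ cs) U σ
    covered e ∣e∣≡r Ue = by-cases (coveredBy? c v e) (covered′ e ∣e∣≡r)
      where
      Goal : Set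
      Goal = Σ (Fin k) λ i → L e i ∈ₗ c ∷ cs × relabel (σ (L e i) ⟨$⟩ʳ_) G e ≡ true
      by-cases : (d : Dec (CoveredBy c v e)) →
        (U e ∧ not (does d) ≡ true → Σ (Fin k) λ i → L e i ∈ₗ cs × relabel (σ′ (L e i) ⟨$⟩ʳ_) G e ≡ true) → Goal
      by-cases (yes ((i , Lei≡c) , hit)) _ =
        i , here Lei≡c , subst (λ π → relabel (π ⟨$⟩ʳ_) G e ≡ true)
                               (cong (if_then πᵥ else σ′ (L e i)) (sym (dec-true (L e i ℕ.≟ c) Lei≡c))) (Equivalence.to T-≡ hit)
      by-cases (no _) covered-later =
        let (i , Lei∈cs , hit) = covered-later (cong (_∧ true) Ue)
            Lei≢c = λ Lei≡c → c∉cs (subst (_∈ₗ cs) Lei≡c Lei∈cs)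
        in i , there Lei∈cs , subst (λ π → relabel (π ⟨$⟩ʳ_) G e ≡ true)
                                    (cong (if_then πᵥ else σ′ (L e i)) (sym (dec-false (L e i ℕ.≟ c) Lei≢c))) hit

  cover : (cs : List ℕ) (U : Subset n → Bool) → potential cs U < N ^ k → Σ (ℕ → Permutation′ n) (Covered cs U)
  cover [] U small = (λ _ → Perm.id) , λ e ∣e∣≡r Ue → ⊥-elim (<⇒≱ small (N^k≤potential-[] U e ∣e∣≡r Ue))
  cover (c ∷ cs) U small with c ∈? cs
  ... | yes c∈cs =
    let (σ , covered) = cover cs U (subst (_< N ^ k) (potential-∷-∈ c∈cs U) small)
    in σ , λ e ∣e∣≡r Ue → let (i , Lei∈cs , hit) = covered e ∣e∣≡r Ue in i , there Lei∈cs , hit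
  ... | no c∉cs =
    let (v , v-injective , small′) = ∃-good-table c∉cs U small
    in Covered-extend c∉cs U v v-injective (cover cs (uncoveredBy c v U) small′)

-- List colourings

ListColourable : (r : ℕ) {v : ℕ} → RGraph v → (k n : ℕ) → Set
ListColourable r H k n =
  (L : ListAssignment r k n) → Σ (Subset n → ℕ) λ c → IsLColouring L c × ¬ MonoCopy r H c

colours : {n k : ℕ} → (Subset n → Fin k → ℕ) → List ℕ
colours {n} L = List.concatMap (List.tabulate ∘ L) (allSubsets n)

∈-colours : {n k : ℕ} (L : Subset n → Fin k → ℕ) (e : Subset n) (i : Fin k) → L e i ∈ₗ colours L
∈-colours L e i = ∈-concatMap⁺ (List.tabulate ∘ L) (lose (∈-allSubsets e) (∈-tabulate⁺ i))

module _ {n k : ℕ} (G : RGraph n) (L : Subset n → Fin k → ℕ) (σ : ℕ → Permutation′ n) where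

  colourBy : Subset n → ℕ
  colourBy e with Fin.any? (λ i → T? (relabel (σ (L e i) ⟨$⟩ʳ_) G e))
  ... | yes (i , _) = L e i
  ... | no _ = 0

  colourBy-covered : (e : Subset n) → Σ (Fin k) (λ i → T (relabel (σ (L e i) ⟨$⟩ʳ_) G e)) →
    Σ (Fin k) (λ i → L e i ≡ colourBy e) × relabel (σ (colourBy e) ⟨$⟩ʳ_) G e ≡ true
  colourBy-covered e hit with Fin.any? (λ i → T? (relabel (σ (L e i) ⟨$⟩ʳ_) G e))
  ... | yes (i , hitᵢ) = (i , refl) , Equivalence.to T-≡ hitᵢ
  ... | no miss = ⊥-elim (miss hit)

list-colourable : (r : ℕ) {v : ℕ} (H : RGraph v) {k n : ℕ} → 1 ≤ k → (G : RGraph n) → ¬ ContainsCopy r H G →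
  n ^ r * (#rSets r n ∸ edges r G) ^ k < #rSets r n ^ k → ListColourable r H k n
list-colourable r H {k} {n} 1≤k G H-free few-misses (L , L-injective) = colourBy G L σ , is-L-colouring , no-mono
  where
  N>0 : 0 < #rSets r n
  N>0 = base-positive 1≤k few-misses
    where
    base-positive : ∀ {a b m} → 1 ≤ m → a < b ^ m → 0 < b
    base-positive {b = suc _} _ _ = ℕ.z<s
    base-positive {b = zero} {m = suc _} _ ()

  open Derandomisation G L L-injective N>0

  potential-colours : potential (colours L) (λ _ → true) ≡ N * (N ∸ ex) ^ k
  potential-colours = trans (∑-cong (allSubsets n) λ e → cong (𝟙[ ∣ e ∣ ℕ.≟ r ] *_)
      (trans (*-identityˡ _) (trans (∏-cong k (λ i → weight-∈ (colours L) (L e i) (∈-colours L e i))) (∏-const k (N ∸ ex)))))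
    (sym (*-distribʳ-∑ _ (allSubsets n) _))

  small : potential (colours L) (λ _ → true) < N ^ k
  small = begin-strict
    potential (colours L) (λ _ → true)   ≡⟨ potential-colours ⟩
    N * (N ∸ ex) ^ k                 ≤⟨ *-monoˡ-≤ _ (subst (_≤ n ^ r) (sym (#rSets≡C r n)) (C≤^ n r)) ⟩
    n ^ r * (N ∸ ex) ^ k             <⟨ few-misses ⟩
    N ^ k                            ∎
    where open ≤-Reasoning

  σ : ℕ → Permutation′ n
  σ = proj₁ (cover (colours L) (λ _ → true) small)

  coloured : ∀ e → ∣ e ∣ ≡ r → Σ (Fin k) (λ i → L e i ≡ colourBy G L σ e) × relabel (σ (colourBy G L σ e) ⟨$⟩ʳ_) G e ≡ true
  coloured e ∣e∣≡r = let (i , _ , hit) = proj₂ (cover (colours L) (λ _ → true) small) e ∣e∣≡r refl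
                     in colourBy-covered G L σ e (i , Equivalence.from T-≡ hit)

  is-L-colouring : IsLColouring (L , L-injective) (colourBy G L σ)
  is-L-colouring e ∣e∣≡r = proj₁ (coloured e ∣e∣≡r)

  no-mono : ¬ MonoCopy r H (colourBy G L σ)
  no-mono (c , φ , φ-injective , copy) = H-free (ContainsCopy-relabel r H G (σ c) (φ , φ-injective , copy-in-σc))
    where
    copy-in-σc : (s : Subset _) → IsEdge r H s → Σ (Subset n) λ t → ImageOf φ s t × IsEdge r (relabel (σ c ⟨$⟩ʳ_) G) t
    copy-in-σc s s∈H = let (t , image , ∣t∣≡r , t↦c) = copy s s∈H
                       in t , image , ∣t∣≡r , subst (λ x → relabel (σ x ⟨$⟩ʳ_) G t ≡ true) t↦c (proj₂ (coloured t ∣t∣≡r))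

pad : {m : ℕ} (d : ℕ) → Subset m → Subset (m + d)
pad d s = s Vec.++ Vec.replicate d false

take-pad : {m : ℕ} (d : ℕ) (s : Subset m) → Vec.take m (pad d s) ≡ s
take-pad {m} d s = Vec.++-injectiveˡ _ s (Vec.take++drop≡id m (pad d s))

∣pad∣ : {m : ℕ} (d : ℕ) (s : Subset m) → ∣ pad d s ∣ ≡ ∣ s ∣
∣pad∣ d [] = ∣⊥∣≡0 d
∣pad∣ d (true ∷ s) = cong suc (∣pad∣ d s)
∣pad∣ d (false ∷ s) = ∣pad∣ d s

ImageOf-pad : {v m : ℕ} (d : ℕ) {φ : Fin v → Fin m} {s : Subset v} {t : Subset m} →
  ImageOf φ s t → ImageOf ((Fin._↑ˡ d) ∘ φ) s (pad d t)
ImageOf-pad {m = m} d {φ} {s} {t} image y with Fin.splitAt m y in splitAt≡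
... | inj₁ z rewrite sym (Fin.splitAt⁻¹-↑ˡ splitAt≡) = to , from
  where
  lookup-pad : lookup (pad d t) (z Fin.↑ˡ d) ≡ lookup t z
  lookup-pad = Vec.lookup-++ˡ t (Vec.replicate d false) z
  to : z Fin.↑ˡ d ∈ pad d t → Σ (Fin _) λ x → (x ∈ s) × (φ x Fin.↑ˡ d ≡ z Fin.↑ˡ d)
  to z∈ = let (x , x∈s , φx≡z) = proj₁ (image z) (Vec.lookup⇒[]= z t (trans (sym lookup-pad) (Vec.[]=⇒lookup z∈)))
          in x , x∈s , cong (Fin._↑ˡ d) φx≡z
  from : Σ (Fin _) (λ x → (x ∈ s) × (φ x Fin.↑ˡ d ≡ z Fin.↑ˡ d)) → z Fin.↑ˡ d ∈ pad d t
  from (x , x∈s , φx≡z) = Vec.lookup⇒[]= _ (pad d t) (trans lookup-pad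
    (Vec.[]=⇒lookup (proj₂ (image z) (x , x∈s , Fin.↑ˡ-injective d _ _ φx≡z))))
... | inj₂ z rewrite sym (Fin.splitAt⁻¹-↑ʳ splitAt≡) = (⊥-elim ∘ ∉-padding) , λ (x , _ , φx≡z) → ⊥-elim (↑ˡ≢↑ʳ φx≡z)
  where
  ∉-padding : m Fin.↑ʳ z ∈ pad d t → ⊥
  ∉-padding z∈ with () ← trans (sym (Vec.[]=⇒lookup z∈)) (trans (Vec.lookup-++ʳ t (Vec.replicate d false) z) (Vec.lookup-replicate z false))
  ↑ˡ≢↑ʳ : ∀ {x} → x Fin.↑ˡ d ≡ m Fin.↑ʳ z → ⊥
  ↑ˡ≢↑ʳ {x} eq with () ← trans (sym (Fin.splitAt-↑ˡ m x d)) (trans (cong (Fin.splitAt m) eq) (Fin.splitAt-↑ʳ m d z))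

ListColourable⇒¬ListRamseyHolds : (r : ℕ) {v : ℕ} (H : RGraph v) (k n : ℕ) →
  ListColourable r H k n → ¬ ListRamseyHolds r H k n
ListColourable⇒¬ListRamseyHolds r H k n colourable (L , forced) =
  let (c , is-L-colouring , no-mono) = colourable L in no-mono (forced c is-L-colouring)

ListColourable-shrink : (r : ℕ) {v : ℕ} (H : RGraph v) (k m d : ℕ) →
  ListColourable r H k (m + d) → ListColourable r H k m
ListColourable-shrink r H k m d colourable (L , L-injective) = c ∘ pad d , is-L-colouring , no-mono
  where
  restrictedList : (s : Subset (m + d)) → Dec (∣ Vec.take m s ∣ ≡ r) → Fin k → ℕ
  restrictedList s (yes _) = L (Vec.take m s)
  restrictedList s (no _) = Fin.toℕ
  restrictedList-injective : ∀ s r? → Injective _≡_ _≡_ (restrictedList s r?)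
  restrictedList-injective s (yes ∣take∣≡r) = L-injective (Vec.take m s) ∣take∣≡r
  restrictedList-injective s (no _) = Fin.toℕ-injective
  restrictedList-pad : ∀ s → ∣ s ∣ ≡ r → ∀ r? → restrictedList (pad d s) r? ≡ L s
  restrictedList-pad s _ (yes _) = cong L (take-pad d s)
  restrictedList-pad s ∣s∣≡r (no ∣take∣≢r) = ⊥-elim (∣take∣≢r (trans (cong ∣_∣ (take-pad d s)) ∣s∣≡r))
  L⁺ : ListAssignment r k (m + d)
  L⁺ = (λ s → restrictedList s (∣ Vec.take m s ∣ ℕ.≟ r)) , (λ s _ → restrictedList-injective s (∣ Vec.take m s ∣ ℕ.≟ r))
  c : Subset (m + d) → ℕ
  c = proj₁ (colourable L⁺)
  is-L-colouring : IsLColouring (L , L-injective) (c ∘ pad d)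
  is-L-colouring s ∣s∣≡r =
    let (i , L⁺i≡c) = proj₁ (proj₂ (colourable L⁺)) (pad d s) (trans (∣pad∣ d s) ∣s∣≡r)
    in i , trans (sym (cong (λ l → l i) (restrictedList-pad s ∣s∣≡r (∣ Vec.take m (pad d s) ∣ ℕ.≟ r)))) L⁺i≡c
  no-mono : ¬ MonoCopy r H (c ∘ pad d)
  no-mono (col , φ , φ-injective , copy) = proj₂ (proj₂ (colourable L⁺))
    (col , (Fin._↑ˡ d) ∘ φ , φ-injective ∘ Fin.↑ˡ-injective d _ _ , λ s s∈H →
      let (t , image , ∣t∣≡r , t↦col) = copy s s∈H in pad d t , ImageOf-pad d image , trans (∣pad∣ d t) ∣t∣≡r , t↦col)

proposition4 : (r v : ℕ) (H : RGraph v) (k n : ℕ) → 1 ≤ k → 1 ≤ n →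
    (ex : ℕ) → IsEx r n H ex →
    n ^ r * ((n C r) ∸ ex) ^ k < (n C r) ^ k →
    ListRamseyGreater r H k n
proposition4 r v H k n 1≤k _ ex ((G , H-free , edgeCount≡ex) , _) few-misses n′ n′≤n =
  ListColourable⇒¬ListRamseyHolds r H k n′
    (ListColourable-shrink r H k n′ (n ∸ n′) (subst (ListColourable r H k) (sym (m+[n∸m]≡n n′≤n)) colourable))
  where
  edges≡ex : edges r G ≡ ex
  edges≡ex = trans (sym (edgeCount≡edges r G)) edgeCount≡ex
  colourable : ListColourable r H k n
  colourable = list-colourable r H 1≤k G H-free
    (subst₂ (λ N e → n ^ r * (N ∸ e) ^ k < N ^ k) (sym (#rSets≡C r n)) (sym edges≡ex) few-misses)
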